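{- $L_{wp}(k) \in \mathrm{S}^{>}$ for any $k \ge 2$.
   Context: For a finitely generated free group $\mathcal{G}^k=(G,\circ)$ of rank $k$ with basis $\Sigma=\{\sigma_1,\dots,\sigma_k,\sigma_1^{ -1},\dots,\sigma_k^{ -1}\}$ (used as the alphabet), the word problem language is $L_{wp}(k)=\{w=w_1\cdots w_{|w|}\in\Sigma^* \mid w_1\circ\cdots\circ w_{|w|}=\imath\}$, where $\imath$ is the identity element (free groups of equal rank are isomorphic, so this depends only on $k$). Let $\Gamma=\Sigma\cup\{¢,\$\}$, where ¢ and \$ are left and right end-markers. A PFA $\mathcal{P}=(S,\Sigma,\{\mathsf{A}_\sigma:\sigma\in\Gamma\},F)$ has states $S=\{s_1,\dots,s_n\}$ (start state $s_1$), real stochastic transition matrices $\mathsf{A}_\sigma$, and accepting states $F$; its acceptance probability on $w$ is $f_{\mathcal{P}}(w)=\sum_{s_i\in F}\mathsf{v}(i)$, $\mathsf{v}=(1,0,\dots,0)\mathsf{A}_{¢}\mathsf{A}_{w_1}\cdots\mathsf{A}_{w_{|w|}}\mathsf{A}_{\$}$. $\mathrm{S}^{>}$ (stochastic languages) is the class of languages $\{w:f_{\mathcal{P}}(w)>\lambda\}$ for a PFA $\mathcal{P}$ and $\lambda\in[0,1)$. -}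

module Defs where

open import Data.Nat using (ℕ; zero; suc)
open import Data.Fin using (Fin; zero; suc)
open import Data.Bool using (Bool; true; false; if_then_else_)
open import Data.List using (List; []; _∷_; foldr)
open import Data.Product using (Σ; _×_; _,_; ∃)
open import Data.Sum using (_⊎_; inj₁; inj₂)
open import Relation.Binary.PropositionalEquality using (_≡_)
open import Relation.Nullary using (¬_)
open import Relation.Nullary.Decidable using (Dec; yes; no)
open import Data.Fin using (_≟_)

-- The real numbers, axiomatised as a complete ordered field
-- (with propositional equality).  The theorem is stated for every
-- model of these axioms, i.e. for "the" real numbers.

record RealField : Set₁ where
  field
    ℝ    : Set
    0ℝ 1ℝ : ℝ
    _+_ _*_ : ℝ → ℝ → ℝ
    -_   : ℝ → ℝ
    _<_  : ℝ → ℝ → Set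
    inv  : (x : ℝ) → ¬ (x ≡ 0ℝ) → ℝ
    +-assoc : ∀ x y z → (x + y) + z ≡ x + (y + z)
    +-comm  : ∀ x y → x + y ≡ y + x
    +-identityˡ : ∀ x → 0ℝ + x ≡ x
    +-inverseˡ  : ∀ x → (- x) + x ≡ 0ℝ
    *-assoc : ∀ x y z → (x * y) * z ≡ x * (y * z)
    *-comm  : ∀ x y → x * y ≡ y * x
    *-identityˡ : ∀ x → 1ℝ * x ≡ x
    *-inverseˡ  : ∀ x (x≢0 : ¬ (x ≡ 0ℝ)) → inv x x≢0 * x ≡ 1ℝ
    distribˡ : ∀ x y z → x * (y + z) ≡ (x * y) + (x * z)
    0≢1 : ¬ (0ℝ ≡ 1ℝ)
    <-irrefl : ∀ x → ¬ (x < x)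
    <-trans  : ∀ x y z → x < y → y < z → x < z
    <-trichotomy : ∀ x y → (x < y) ⊎ ((x ≡ y) ⊎ (y < x))
    +-mono-<  : ∀ x y z → x < y → (x + z) < (y + z)
    *-pos     : ∀ x y → 0ℝ < x → 0ℝ < y → 0ℝ < (x * y)

  _≤_ : ℝ → ℝ → Set
  x ≤ y = (x < y) ⊎ (x ≡ y)

  field
    sup : (P : ℝ → Set) → (∃ λ x → P x) → (∃ λ b → ∀ x → P x → x ≤ b) →
          ∃ λ s → (∀ x → P x → x ≤ s) × (∀ b → (∀ x → P x → x ≤ b) → s ≤ b)

-- Free group of rank k: alphabet Σ = {σ₁..σₖ, σ₁⁻¹..σₖ⁻¹}.
-- inj₁ i = σᵢ , inj₂ i = σᵢ⁻¹.

Letter : ℕ → Set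
Letter k = Fin k ⊎ Fin k

inverse : ∀ {k} → Letter k → Letter k
inverse (inj₁ i) = inj₂ i
inverse (inj₂ i) = inj₁ i

letter-eq? : ∀ {k} (a b : Letter k) → Bool
letter-eq? (inj₁ i) (inj₁ j) with i ≟ j
... | yes _ = true
... | no _  = false
letter-eq? (inj₂ i) (inj₂ j) with i ≟ j
... | yes _ = true
... | no _  = false
letter-eq? _ _ = false

cons-reduce : ∀ {k} → Letter k → List (Letter k) → List (Letter k)
cons-reduce a [] = a ∷ []
cons-reduce a (b ∷ w) = if letter-eq? (inverse a) b then w else (a ∷ b ∷ w)

-- Free reduction: the element of the free group (as a reduced word)
-- represented by the word w₁⋯wₙ, i.e. w₁ ∘ ⋯ ∘ wₙ.
reduce : ∀ {k} → List (Letter k) → List (Letter k)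
reduce = foldr cons-reduce []

Lwp : (k : ℕ) → List (Letter k) → Set
Lwp k w = reduce w ≡ []

data EndMarked (A : Set) : Set where
  sym    : A → EndMarked A
  cent   : EndMarked A
  dollar : EndMarked A

module _ (R : RealField) where
  open RealField R

  sumFin : ∀ {n} → (Fin n → ℝ) → ℝ
  sumFin {zero}  f = 0ℝ
  sumFin {suc n} f = f zero + sumFin (λ i → f (suc i))

  Matrix : ℕ → Set
  Matrix n = Fin n → Fin n → ℝ

  Stochastic : ∀ {n} → Matrix n → Set
  Stochastic {n} M = (∀ i j → 0ℝ ≤ M i j) × (∀ i → sumFin (λ j → M i j) ≡ 1ℝ)

  -- PFA with n states s₁..sₙ (Fin n, start state = zero),
  -- transition matrices for each symbol of Γ, accepting states F.
  record PFA (Σ : Set) (n : ℕ) : Set where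
    field
      mat        : EndMarked Σ → Matrix n
      stochastic : ∀ σ → Stochastic (mat σ)
      accepting  : Fin n → Bool

  _·_ : ∀ {n} → (Fin n → ℝ) → Matrix n → (Fin n → ℝ)
  (v · M) j = sumFin (λ i → v i * M i j)

  initVec : ∀ {n} → Fin n → ℝ
  initVec zero    = 1ℝ
  initVec (suc _) = 0ℝ

  run : ∀ {Σ n} → PFA Σ n → (Fin n → ℝ) → List Σ → (Fin n → ℝ)
  run P v []      = v
  run P v (a ∷ w) = run P (v · PFA.mat P (sym a)) w

  accProb : ∀ {Σ n} → PFA Σ n → List Σ → ℝ
  accProb P w =
    let v = run P (initVec · PFA.mat P cent) w · PFA.mat P dollar
    in sumFin (λ i → if PFA.accepting P i then v i else 0ℝ)

  -- L ∈ S^> : L = { w : f_P(w) > λ } for some PFA P and λ ∈ [0,1).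
  Stochastic-Language : (A : Set) → (List A → Set) → Set
  Stochastic-Language A L =
    Σ ℕ λ n → Σ (PFA A (suc n)) λ P → Σ ℝ λ λ' →
      (0ℝ ≤ λ') × (λ' < 1ℝ) ×
      (∀ w → (L w → λ' < accProb P w) × (λ' < accProb P w → L w))

module Submission where

-- For t ∈ ℤ and s = ±1 the shear generator t s maps (x , y) to (x + 5 s u , y + 5 s t u), where
-- u = y − t x; it fixes the line y = t x.  Ping-pong with the cones {s x u > 0, 5 |u| ≤ 2 |x|}
-- shows that a nonempty reduced word w in the shears with t = 0, …, k − 1 moves (0 , 1) to a point
-- (x_w , y_w) with x_w ≠ 0, so w is trivial in the free group iff x_w = 0.
-- The vector (x_w², x_w y_w, y_w²) evolves linearly under the integer symmetric squares of the
-- shears.  A PFA tracks an integer vector q evolving under integer matrices as follows: a reference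
-- state carries mass z > 0 and a pair of states (pos j , neg j) carries masses whose difference is
-- q_j z; a letter redistributes mass along the positive and negative parts of its matrix, scaled by
-- 1 / (K + 1), and sends the excess to a sink.  The end-marker turns the acceptance probability
-- into ½ + ½ z (1 − x_w²), which exceeds ½ exactly when x_w = 0.

open import Defs renaming (sym to symbol)
open import Data.Nat using (ℕ; _≥_; zero; suc)

open import Algebra.Bundles using (Monoid; CommutativeMonoid; CommutativeRing)
open import Algebra.Structures using (IsCommutativeRing)
import Algebra.Properties.Monoid.Sum as MonoidSum
open import Data.Bool using (Bool; true; false; if_then_else_)
open import Data.Empty using (⊥-elim)
open import Data.Fin as Fin using (Fin; zero; suc; _↑ˡ_; _↑ʳ_; splitAt; toℕ)
import Data.Fin.Properties as Fin
open import Data.Integer as ℤ using (ℤ; +_; -[1+_]; 0ℤ; 1ℤ; _◃_; ∣_∣)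
import Data.Integer.Properties as ℤ
open import Data.Integer.Tactic.RingSolver using (solve-∀)
open import Data.List using (List; []; _∷_)
open import Data.List.Relation.Unary.Linked as Linked using (Linked; []; [-]; _∷_)
open import Data.Maybe using (just; nothing)
import Data.Nat as ℕ
import Data.Nat.Properties as ℕ
open import Data.Product using (_×_; _,_; proj₁; proj₂; ∃)
open import Data.Sign as Sign using (Sign)
open import Data.Sum as Sum using (inj₁; inj₂; [_,_]′)
open import Function using (_∘_; _⇔_; mk⇔; Equivalence)
import Function.Properties.Equivalence as ⇔
open import Relation.Binary.Definitions using (WeaklyDecidable)
open import Relation.Binary.PropositionalEquality as ≡ using (_≡_; _≢_; refl; _≗_)
open import Relation.Nullary using (¬_)
open import Relation.Nullary.Decidable using (yes; no)

module ℕΣ = MonoidSum ℕ.+-0-monoid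
module ℤΣ = MonoidSum ℤ.+-0-monoid

positivePart negativePart : ℤ → ℕ
positivePart (+ m)    = m
positivePart -[1+ m ] = 0
negativePart (+ m)    = 0
negativePart -[1+ m ] = suc m

positivePart+negativePart : ∀ i → positivePart i ℕ.+ negativePart i ≡ ∣ i ∣
positivePart+negativePart (+ m)    = ℕ.+-identityʳ m
positivePart+negativePart -[1+ m ] = refl

i*i≡∣i∣*∣i∣ : ∀ i → i ℤ.* i ≡ + (∣ i ∣ ℕ.* ∣ i ∣)
i*i≡∣i∣*∣i∣ (+ n)    = ℤ.+◃n≡+n (n ℕ.* n)
i*i≡∣i∣*∣i∣ -[1+ n ] = ℤ.+◃n≡+n _

i≡0⇔∣i∣*∣i∣≡0 : ∀ i → i ≡ 0ℤ ⇔ ∣ i ∣ ℕ.* ∣ i ∣ ≡ 0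
i≡0⇔∣i∣*∣i∣≡0 i = mk⇔ (λ { refl → refl }) (ℤ.∣i∣≡0⇒i≡0 ∘ Sum.reduce ∘ ℕ.m*n≡0⇒m≡0∨n≡0 ∣ i ∣)

infixl 7 _ᵛ*_
_ᵛ*_ : ∀ {n} → (Fin n → ℤ) → (Fin n → Fin n → ℤ) → Fin n → ℤ
(q ᵛ* M) j = ℤΣ.sum (λ l → q l ℤ.* M l j)

linearOrbit : ∀ {A : Set} {n} → (A → Fin n → Fin n → ℤ) → (Fin n → ℤ) → List A → Fin n → ℤ
linearOrbit M q []      = q
linearOrbit M q (a ∷ w) = linearOrbit M (q ᵛ* M a) w

linearOrbit-cong : ∀ {A : Set} {n} (M : A → Fin n → Fin n → ℤ) {q q′} → q ≗ q′ →
                   ∀ w → linearOrbit M q w ≗ linearOrbit M q′ w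
linearOrbit-cong M q≗q′ []      = q≗q′
linearOrbit-cong M q≗q′ (a ∷ w) =
  linearOrbit-cong M (λ j → ℤΣ.sum-cong-≗ (λ l → ≡.cong (ℤ._* M a l j) (q≗q′ l))) w

≤-sum : ∀ {m} (t : Fin m → ℕ) l → t l ℕ.≤ ℕΣ.sum t
≤-sum t zero    = ℕ.m≤m+n (t zero) _
≤-sum t (suc l) = ℕ.≤-trans (≤-sum (t ∘ suc) l) (ℕ.m≤n+m _ (t zero))

module IntegerEmbedding {c ℓ} (R : CommutativeRing c ℓ) where
  open CommutativeRing R hiding (zero) renaming (refl to ≈-refl)
  open import Algebra.Properties.Ring ring using (-‿distribˡ-*; -0#≈0#; -‿involutive)
  open import Algebra.Properties.AbelianGroup +-abelianGroup using (⁻¹-∙-comm)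
  open import Algebra.Properties.Semiring.Mult semiring using (×-homo-+) renaming (_×_ to _×ᵣ_)
  open import Algebra.Solver.Ring.AlmostCommutativeRing using (_-Raw-AlmostCommutative⟶_; fromCommutativeRing)
  open import Algebra.Properties.Monoid.Sum +-monoid using (sum)
  open import Relation.Binary.Reasoning.Setoid setoid

  ι : ℤ → Carrier
  ι (+ n)    = n ×ᵣ 1#
  ι -[1+ n ] = - (suc n ×ᵣ 1#)

  private
    x-0≈x : ∀ x → x - 0# ≈ x
    x-0≈x x = trans (+-congˡ -0#≈0#) (+-identityʳ x)

    [a+b]-[a+c]≈b-c : ∀ a b c → (a + b) - (a + c) ≈ b - c
    [a+b]-[a+c]≈b-c a b c = begin
      (a + b) - (a + c)     ≈⟨ +-congˡ (⁻¹-∙-comm a c) ⟨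
      (a + b) + (- a - c)   ≈⟨ +-assoc a b (- a - c) ⟩
      a + (b + (- a - c))   ≈⟨ +-congˡ (trans (sym (+-assoc b (- a) (- c))) (+-congʳ (+-comm b (- a)))) ⟩
      a + ((- a + b) - c)   ≈⟨ +-congˡ (+-assoc (- a) b (- c)) ⟩
      a + (- a + (b - c))   ≈⟨ +-assoc a (- a) (b - c) ⟨
      (a - a) + (b - c)     ≈⟨ +-congʳ (-‿inverseʳ a) ⟩
      0# + (b - c)          ≈⟨ +-identityˡ (b - c) ⟩
      b - c                 ∎

  ι-⊖ : ∀ m n → ι (m ℤ.⊖ n) ≈ m ×ᵣ 1# - n ×ᵣ 1#
  ι-⊖ zero    zero    = sym (x-0≈x 0#)
  ι-⊖ (suc m) zero    = sym (x-0≈x (suc m ×ᵣ 1#))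
  ι-⊖ zero    (suc n) = sym (+-identityˡ _)
  ι-⊖ (suc m) (suc n) = begin
    ι (suc m ℤ.⊖ suc n)        ≡⟨ ≡.cong ι (ℤ.[1+m]⊖[1+n]≡m⊖n m n) ⟩
    ι (m ℤ.⊖ n)                ≈⟨ ι-⊖ m n ⟩
    m ×ᵣ 1# - n ×ᵣ 1#          ≈⟨ [a+b]-[a+c]≈b-c 1# (m ×ᵣ 1#) (n ×ᵣ 1#) ⟨
    suc m ×ᵣ 1# - suc n ×ᵣ 1#  ∎

  ι-+ : ∀ i j → ι (i ℤ.+ j) ≈ ι i + ι j
  ι-+ (+ m)      (+ n)      = ×-homo-+ 1# m n
  ι-+ (+ m)      -[1+ n ]   = ι-⊖ m (suc n)
  ι-+ -[1+ m ]   (+ n)      = trans (ι-⊖ n (suc m)) (+-comm _ _)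
  ι-+ -[1+ m ]   -[1+ n ]   = begin
    - (suc (suc (m ℕ.+ n)) ×ᵣ 1#)  ≡⟨ ≡.cong (λ k → - (k ×ᵣ 1#)) (ℕ.+-suc (suc m) n) ⟨
    - ((suc m ℕ.+ suc n) ×ᵣ 1#)    ≈⟨ -‿cong (×-homo-+ 1# (suc m) (suc n)) ⟩
    - (suc m ×ᵣ 1# + suc n ×ᵣ 1#)  ≈⟨ ⁻¹-∙-comm _ _ ⟨
    ι -[1+ m ] + ι -[1+ n ]        ∎

  ι-neg : ∀ i → ι (ℤ.- i) ≈ - ι i
  ι-neg (+ zero)  = sym -0#≈0#
  ι-neg (+ suc n) = ≈-refl
  ι-neg -[1+ n ]  = sym (-‿involutive _)

  ι-*⁺ : ∀ m j → ι (+ m ℤ.* j) ≈ m ×ᵣ 1# * ι j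
  ι-*⁺ zero    j = sym (zeroˡ (ι j))
  ι-*⁺ (suc m) j = begin
    ι (+ suc m ℤ.* j)         ≡⟨ ≡.cong ι (ℤ.suc-* (+ m) j) ⟩
    ι (j ℤ.+ + m ℤ.* j)       ≈⟨ ι-+ j (+ m ℤ.* j) ⟩
    ι j + ι (+ m ℤ.* j)       ≈⟨ +-congˡ (ι-*⁺ m j) ⟩
    ι j + m ×ᵣ 1# * ι j       ≈⟨ +-congʳ (*-identityˡ (ι j)) ⟨
    1# * ι j + m ×ᵣ 1# * ι j  ≈⟨ distribʳ (ι j) 1# (m ×ᵣ 1#) ⟨
    suc m ×ᵣ 1# * ι j         ∎

  ι-* : ∀ i j → ι (i ℤ.* j) ≈ ι i * ι j
  ι-* (+ m)     j = ι-*⁺ m j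
  ι-* -[1+ m ]  j = begin
    ι (-[1+ m ] ℤ.* j)       ≡⟨ ≡.cong ι (ℤ.neg-distribˡ-* (+ suc m) j) ⟨
    ι (ℤ.- (+ suc m ℤ.* j))  ≈⟨ ι-neg (+ suc m ℤ.* j) ⟩
    - ι (+ suc m ℤ.* j)      ≈⟨ -‿cong (ι-*⁺ (suc m) j) ⟩
    - (suc m ×ᵣ 1# * ι j)    ≈⟨ -‿distribˡ-* _ _ ⟩
    ι -[1+ m ] * ι j         ∎

  ι-sum⁺ : ∀ {m} (f : Fin m → ℕ) → ι (+ ℕΣ.sum f) ≈ sum (λ j → ι (+ f j))
  ι-sum⁺ {zero}  f = ≈-refl
  ι-sum⁺ {suc m} f = trans (ι-+ (+ f zero) (+ ℕΣ.sum (f ∘ suc))) (+-congˡ (ι-sum⁺ (f ∘ suc)))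

  ι-sum : ∀ {m} (f : Fin m → ℤ) → ι (ℤΣ.sum f) ≈ sum (ι ∘ f)
  ι-sum {zero}  f = ≈-refl
  ι-sum {suc m} f = trans (ι-+ (f zero) (ℤΣ.sum (f ∘ suc))) (+-congˡ (ι-sum (f ∘ suc)))

  ι-parts : ∀ i → ι (+ positivePart i) - ι (+ negativePart i) ≈ ι i
  ι-parts (+ m)    = trans (+-congˡ -0#≈0#) (+-identityʳ (ι (+ m)))
  ι-parts -[1+ m ] = +-identityˡ (ι -[1+ m ])

  ι-morphism : ℤ.+-*-rawRing -Raw-AlmostCommutative⟶ fromCommutativeRing R
  ι-morphism = record
    { ⟦_⟧ = ι ; +-homo = ι-+ ; *-homo = ι-* ; -‿homo = ι-neg ; 0-homo = ≈-refl ; 1-homo = +-identityʳ 1# }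

  ι-≟ : WeaklyDecidable (λ i j → ι i ≈ ι j)
  ι-≟ i j with i ℤ.≟ j
  ... | yes refl = just ≈-refl
  ... | no _     = nothing

  open import Algebra.Solver.Ring ℤ.+-*-rawRing (fromCommutativeRing R) ι-morphism ι-≟ public

module _ {a ℓ} (M : Monoid a ℓ) where
  open Monoid M
  open MonoidSum M using (sum)

  sum-↑ : ∀ m {n} (g : Fin (m ℕ.+ n) → Carrier) → sum g ≈ sum (g ∘ (_↑ˡ n)) ∙ sum (g ∘ (m ↑ʳ_))
  sum-↑ zero    g = sym (identityˡ _)
  sum-↑ (suc m) g = trans (∙-congˡ (sum-↑ m (g ∘ suc))) (sym (assoc _ _ _))

stateCount : ℕ → ℕ
stateCount n = suc (suc (n ℕ.+ n))

data Role (n : ℕ) : Set where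
  ref sink : Role n
  pos neg  : Fin n → Role n

module _ {n : ℕ} where

  state : Role n → Fin (stateCount n)
  state ref     = zero
  state sink    = suc zero
  state (pos j) = suc (suc (j ↑ˡ n))
  state (neg j) = suc (suc (n ↑ʳ j))

  role : Fin (stateCount n) → Role n
  role zero          = ref
  role (suc zero)    = sink
  role (suc (suc i)) = [ pos , neg ]′ (splitAt n i)

  role-state : ∀ r → role (state r) ≡ r
  role-state ref     = refl
  role-state sink    = refl
  role-state (pos j) = ≡.cong [ pos , neg ]′ (Fin.splitAt-↑ˡ n j n)
  role-state (neg j) = ≡.cong [ pos , neg ]′ (Fin.splitAt-↑ʳ n n j)

module RoleSum {a ℓ} (M : CommutativeMonoid a ℓ) {n : ℕ} where
  open CommutativeMonoid M renaming (_∙_ to _+_)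
  open import Algebra.Properties.CommutativeMonoid.Sum M using (sum; sum-cong-≗; ∑-distrib-+)
  open import Relation.Binary.Reasoning.Setoid setoid

  Σᴿ : (Role n → Carrier) → Carrier
  Σᴿ g = g ref + (g sink + sum (λ j → g (pos j) + g (neg j)))

  sum-by-role : ∀ (g : Fin (stateCount n) → Role n → Carrier) →
                sum (λ i → g i (role i)) ≈ Σᴿ (λ r → g (state r) r)
  sum-by-role g = ∙-congˡ (∙-congˡ (begin
    sum (λ i → g (suc (suc i)) (role (suc (suc i))))
      ≈⟨ sum-↑ monoid n _ ⟩
    sum {n} (λ j → g (state (pos j)) (role (state (pos j)))) + sum {n} (λ j → g (state (neg j)) (role (state (neg j))))
      ≡⟨ ≡.cong₂ _+_ (sum-cong-≗ λ j → ≡.cong (g _) (role-state (pos j)))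
                     (sum-cong-≗ λ j → ≡.cong (g _) (role-state (neg j))) ⟩
    sum {n} (λ j → g (state (pos j)) (pos j)) + sum {n} (λ j → g (state (neg j)) (neg j))
      ≈⟨ ∑-distrib-+ (λ j → g (state (pos j)) (pos j)) (λ j → g (state (neg j)) (neg j)) ⟨
    sum (λ j → g (state (pos j)) (pos j) + g (state (neg j)) (neg j)) ∎))

module SymmetricSquare where
  open import Data.Integer using (_+_; _*_)

  ℤ² : Set
  ℤ² = ℤ × ℤ

  record Mat₂ : Set where
    constructor mat₂
    field a b c d : ℤ

  infixl 7 _·₂_
  _·₂_ : ℤ² → Mat₂ → ℤ²
  (x , y) ·₂ mat₂ a b c d = (x * a + y * c , x * b + y * d)

  quad : ℤ² → Fin 3 → ℤ
  quad (x , y) zero             = x * x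
  quad (x , y) (suc zero)       = x * y
  quad (x , y) (suc (suc zero)) = y * y

  Sym² : Mat₂ → Fin 3 → Fin 3 → ℤ
  Sym² (mat₂ a b c d) zero             zero             = a * a
  Sym² (mat₂ a b c d) zero             (suc zero)       = a * b
  Sym² (mat₂ a b c d) zero             (suc (suc zero)) = b * b
  Sym² (mat₂ a b c d) (suc zero)       zero             = + 2 * a * c
  Sym² (mat₂ a b c d) (suc zero)       (suc zero)       = a * d + b * c
  Sym² (mat₂ a b c d) (suc zero)       (suc (suc zero)) = + 2 * b * d
  Sym² (mat₂ a b c d) (suc (suc zero)) zero             = c * c
  Sym² (mat₂ a b c d) (suc (suc zero)) (suc zero)       = c * d
  Sym² (mat₂ a b c d) (suc (suc zero)) (suc (suc zero)) = d * d

  private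
    square : ∀ x y a c → (x * a + y * c) * (x * a + y * c) ≡
                         x * x * (a * a) + (x * y * (+ 2 * a * c) + (y * y * (c * c) + + 0))
    square = solve-∀

  quad-·₂ : ∀ p G j → quad (p ·₂ G) j ≡ (quad p ᵛ* Sym² G) j
  quad-·₂ (x , y) (mat₂ a b c d) zero             = square x y a c
  quad-·₂ (x , y) (mat₂ a b c d) (suc zero)       = product x y a b c d
    where
    product : ∀ x y a b c d → (x * a + y * c) * (x * b + y * d) ≡
                              x * x * (a * b) + (x * y * (a * d + b * c) + (y * y * (c * d) + + 0))
    product = solve-∀
  quad-·₂ (x , y) (mat₂ a b c d) (suc (suc zero)) = square x y b d


open SymmetricSquare

module PingPong where
  open import Data.Integer using (_+_; _*_; _-_; -_; _≤_; _<_)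
  open ≡ using (sym; trans; cong; cong₂; subst; subst₂)

  ε : Sign → ℤ
  ε s = s ◃ 1

  ε-opposite : ∀ s → ε (Sign.opposite s) ≡ - ε s
  ε-opposite Sign.- = refl
  ε-opposite Sign.+ = refl

  ε*ε : ∀ s → ε s * ε s ≡ 1ℤ
  ε*ε Sign.- = refl
  ε*ε Sign.+ = refl

  ∣ε∣ : ∀ s → ∣ ε s ∣ ≡ 1
  ∣ε∣ Sign.- = refl
  ∣ε∣ Sign.+ = refl

  u : ℤ → ℤ² → ℤ
  u t (x , y) = y - t * x

  shear : ℤ → ℤ → Mat₂
  shear t m = mat₂ (1ℤ - m * t) (- (m * t * t)) m (1ℤ + m * t)

  generator : ℤ → Sign → Mat₂
  generator t s = shear t (ε s * + 5)

  u-shear : ∀ t m p → u t (p ·₂ shear t m) ≡ u t p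
  u-shear t m (x , y) = invariant t m x y
    where
    invariant : ∀ t m x y → (x * (- (m * t * t)) + y * (1ℤ + m * t)) - t * (x * (1ℤ - m * t) + y * m) ≡ y - t * x
    invariant = solve-∀

  x-shear : ∀ t m p → proj₁ (p ·₂ shear t m) ≡ proj₁ p + m * u t p
  x-shear t m (x , y) = image t m x y
    where
    image : ∀ t m x y → x * (1ℤ - m * t) + y * m ≡ x + m * (y - t * x)
    image = solve-∀

  shear-inverse : ∀ t m p → p ·₂ shear t m ·₂ shear t (- m) ≡ p
  shear-inverse t m (x , y) = cong₂ _,_ (first t m x y) (second t m x y)
    where
    first : ∀ t m x y → (x * (1ℤ - m * t) + y * m) * (1ℤ - (- m) * t)
                        + (x * (- (m * t * t)) + y * (1ℤ + m * t)) * (- m) ≡ x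
    first = solve-∀
    second : ∀ t m x y → (x * (1ℤ - m * t) + y * m) * (- ((- m) * t * t))
                         + (x * (- (m * t * t)) + y * (1ℤ + m * t)) * (1ℤ + (- m) * t) ≡ y
    second = solve-∀

  P : ℤ → Sign → ℤ² → ℤ
  P t s p = ε s * proj₁ p * u t p

  Q : ℤ → ℤ² → ℤ
  Q t p = + 5 * (u t p * u t p)

  -- For P > 0, Q ≤ 2 P says 5 |u| ≤ 2 |x| (cone-bounds); unlike |x| and |u|, P and Q transform
  -- linearly under the shear.
  InCone : ℤ → ℤ → Set
  InCone p q = 0ℤ < p × q ≤ + 2 * p

  Cone : ℤ → Sign → ℤ² → Set
  Cone t s p = InCone (P t s p) (Q t p)

  Admissible : ℤ → Sign → ℤ² → Set
  Admissible t s p = u t p ≢ 0ℤ × ¬ Cone t (Sign.opposite s) p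

  P-opposite : ∀ t s p → P t (Sign.opposite s) p ≡ - P t s p
  P-opposite t s (x , y) rewrite ε-opposite s = negate (ε s) x (u t (x , y))
    where
    negate : ∀ e x w → - e * x * w ≡ - (e * x * w)
    negate = solve-∀

  Cone-opposite : ∀ t s p → Cone t (Sign.opposite s) p ≡ InCone (- P t s p) (Q t p)
  Cone-opposite t s p = cong (λ r → InCone r (Q t p)) (P-opposite t s p)

  P-generator : ∀ t s p → P t s (p ·₂ generator t s) ≡ P t s p + Q t p
  P-generator t s p = begin
    ε s * proj₁ (p ·₂ generator t s) * u t (p ·₂ generator t s)
      ≡⟨ cong₂ (λ x w → ε s * x * w) (x-shear t m p) (u-shear t m p) ⟩
    ε s * (x + m * w) * w                         ≡⟨ expand (ε s) x w ⟩
    ε s * x * w + ε s * ε s * (+ 5 * (w * w))     ≡⟨ cong (λ e → ε s * x * w + e * (+ 5 * (w * w))) (ε*ε s) ⟩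
    ε s * x * w + 1ℤ * (+ 5 * (w * w))            ≡⟨ cong (_+_ (ε s * x * w)) (ℤ.*-identityˡ _) ⟩
    ε s * x * w + + 5 * (w * w)                   ∎
    where
    open ≡.≡-Reasoning
    m = ε s * + 5
    x = proj₁ p
    w = u t p
    expand : ∀ e x w → e * (x + e * + 5 * w) * w ≡ e * x * w + e * e * (+ 5 * (w * w))
    expand = solve-∀

  Q-generator : ∀ t s p → Q t (p ·₂ generator t s) ≡ Q t p
  Q-generator t s p = cong (λ w → + 5 * (w * w)) (u-shear t (ε s * + 5) p)

  cone-shift : ∀ p q → 0ℤ < q → ¬ InCone (- p) q → InCone (p + q) q
  cone-shift p q 0<q p∉ with p ℤ.<? 0ℤ
  ... | no p≮0 = ℤ.+-mono-≤-< 0≤p 0<q ,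
                 ℤ.0≤i-j⇒j≤i (subst (0ℤ ≤_) (twice p q) (ℤ.+-mono-≤ (ℤ.+-mono-≤ 0≤p 0≤p) (ℤ.<⇒≤ 0<q)))
    where
    0≤p = ℤ.≮⇒≥ p≮0
    twice : ∀ p q → p + p + q ≡ + 2 * (p + q) - q
    twice = solve-∀
  ... | yes p<0 = ℤ.<-trans 0<-p (subst (_< p + q) (double p) (ℤ.+-monoʳ-< p 2[-p]<q)) ,
                  ℤ.<⇒≤ (subst₂ _<_ (cancel p q) (regroup p q) (ℤ.+-monoˡ-< (+ 2 * p + q) 2[-p]<q))
    where
    0<-p = ℤ.neg-mono-< p<0
    2[-p]<q = ℤ.≰⇒> (λ q≤ → p∉ (0<-p , q≤))
    double : ∀ p → p + + 2 * - p ≡ - p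
    double = solve-∀
    cancel : ∀ p q → + 2 * - p + (+ 2 * p + q) ≡ q
    cancel = solve-∀
    regroup : ∀ p q → q + (+ 2 * p + q) ≡ + 2 * (p + q)
    regroup = solve-∀

  0<5[w*w] : ∀ w → w ≢ 0ℤ → 0ℤ < + 5 * (w * w)
  0<5[w*w] (+ zero)  w≢0 = ⊥-elim (w≢0 refl)
  0<5[w*w] (+ suc n) _ = ℤ.+<+ (ℕ.s≤s ℕ.z≤n)
  0<5[w*w] -[1+ n ]  _   = ℤ.+<+ (ℕ.s≤s ℕ.z≤n)

  generator-enters-cone : ∀ t s p → Admissible t s p → Cone t s (p ·₂ generator t s)
  generator-enters-cone t s p (u≢0 , p∉) =
    subst₂ InCone (sym (P-generator t s p)) (sym (Q-generator t s p))
      (cone-shift (P t s p) (Q t p) (0<5[w*w] (u t p) u≢0) (p∉ ∘ subst (λ X → X) (sym (Cone-opposite t s p))))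

  cone-bounds : ∀ t s p → Cone t s p → 0 ℕ.< ∣ proj₁ p ∣ × 5 ℕ.* ∣ u t p ∣ ℕ.≤ 2 ℕ.* ∣ proj₁ p ∣
  cone-bounds t s p (0<P , Q≤2P) = 0<a , ℕ.*-cancelʳ-≤ (5 ℕ.* b) (2 ℕ.* a) b {{b≢0}} 5bb≤2ab
    where
    a = ∣ proj₁ p ∣
    b = ∣ u t p ∣
    ∣P∣≡ab : ∣ P t s p ∣ ≡ a ℕ.* b
    ∣P∣≡ab = begin
      ∣ ε s * proj₁ p * u t p ∣       ≡⟨ ℤ.abs-* (ε s * proj₁ p) (u t p) ⟩
      ∣ ε s * proj₁ p ∣ ℕ.* b         ≡⟨ cong (ℕ._* b) (ℤ.abs-* (ε s) (proj₁ p)) ⟩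
      ∣ ε s ∣ ℕ.* a ℕ.* b             ≡⟨ cong (λ e → e ℕ.* a ℕ.* b) (∣ε∣ s) ⟩
      1 ℕ.* a ℕ.* b                   ≡⟨ cong (ℕ._* b) (ℕ.*-identityˡ a) ⟩
      a ℕ.* b                         ∎
      where open ≡.≡-Reasoning
    P≡ab : P t s p ≡ + (a ℕ.* b)
    P≡ab = trans (sym (ℤ.0≤i⇒+∣i∣≡i (ℤ.<⇒≤ 0<P))) (cong +_ ∣P∣≡ab)
    0<ab : 0 ℕ.< a ℕ.* b
    0<ab = ℤ.drop‿+<+ (subst (0ℤ <_) P≡ab 0<P)
    0<a = ℕ.>-nonZero⁻¹ a {{ℕ.m*n≢0⇒m≢0 a {{ℕ.>-nonZero 0<ab}}}}
    b≢0 = ℕ.m*n≢0⇒n≢0 a {{ℕ.>-nonZero 0<ab}}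
    Q≡5bb : Q t p ≡ + (5 ℕ.* b ℕ.* b)
    Q≡5bb = trans (cong (+ 5 *_) (i*i≡∣i∣*∣i∣ (u t p)))
                  (trans (sym (ℤ.pos-* 5 (b ℕ.* b))) (cong +_ (sym (ℕ.*-assoc 5 b b))))
    2P≡2ab : + 2 * P t s p ≡ + (2 ℕ.* a ℕ.* b)
    2P≡2ab = trans (cong (+ 2 *_) P≡ab)
                   (trans (sym (ℤ.pos-* 2 (a ℕ.* b))) (cong +_ (sym (ℕ.*-assoc 2 a b))))
    5bb≤2ab : 5 ℕ.* b ℕ.* b ℕ.≤ 2 ℕ.* a ℕ.* b
    5bb≤2ab = ℤ.drop‿+≤+ (subst₂ _≤_ Q≡5bb 2P≡2ab Q≤2P)

  Cone⇒Admissible : ∀ t s p → Cone t s p → Admissible t s p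
  Cone⇒Admissible t s p (0<P , _) = u≢0 , λ c →
    ℤ.<-irrefl refl (0<P+[-P] (proj₁ (subst (λ X → X) (Cone-opposite t s p) c)))
    where
    u≢0 : u t p ≢ 0ℤ
    u≢0 u≡0 = ℤ.<-irrefl refl
      (subst (0ℤ <_) (trans (cong (ε s * proj₁ p *_) u≡0) (ℤ.*-zeroʳ (ε s * proj₁ p))) 0<P)
    0<P+[-P] : 0ℤ < - P t s p → 0ℤ < 0ℤ
    0<P+[-P] 0<-P = subst (0ℤ <_) (ℤ.+-inverseʳ (P t s p)) (ℤ.+-mono-< 0<P 0<-P)

  u-difference : ∀ t t′ p → u t p - u t′ p ≡ (t′ - t) * proj₁ p
  u-difference t t′ (x , y) = difference t t′ x y
    where
    difference : ∀ t t′ x y → (y - t * x) - (y - t′ * x) ≡ (t′ - t) * x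
    difference = solve-∀

  Cone⇒Admissible-other : ∀ t t′ s s′ p → 0 ℕ.< ∣ t′ - t ∣ → Cone t s p → Admissible t′ s′ p
  Cone⇒Admissible-other t t′ s s′ p 0<∣t′-t∣ c = b′≢0 , ¬cone′
    where
    a = ∣ proj₁ p ∣
    b = ∣ u t p ∣
    b′ = ∣ u t′ p ∣
    bounds = cone-bounds t s p c
    a≤b+b′ : a ℕ.≤ b ℕ.+ b′
    a≤b+b′ = ℕ.≤-trans (ℕ.m≤n*m a ∣ t′ - t ∣ {{ℕ.>-nonZero 0<∣t′-t∣}})
      (subst (ℕ._≤ b ℕ.+ b′) (trans (cong ∣_∣ (u-difference t t′ p)) (ℤ.abs-* (t′ - t) (proj₁ p)))
             (ℤ.∣i-j∣≤∣i∣+∣j∣ (u t p) (u t′ p)))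
    3a≤5b′ : 3 ℕ.* a ℕ.≤ 5 ℕ.* b′
    3a≤5b′ = ℕ.+-cancelˡ-≤ (2 ℕ.* a) _ _ (begin
      2 ℕ.* a ℕ.+ 3 ℕ.* a        ≡⟨ ℕ.*-distribʳ-+ a 2 3 ⟨
      5 ℕ.* a                    ≤⟨ ℕ.*-monoʳ-≤ 5 a≤b+b′ ⟩
      5 ℕ.* (b ℕ.+ b′)           ≡⟨ ℕ.*-distribˡ-+ 5 b b′ ⟩
      5 ℕ.* b ℕ.+ 5 ℕ.* b′       ≤⟨ ℕ.+-monoˡ-≤ (5 ℕ.* b′) (proj₂ bounds) ⟩
      2 ℕ.* a ℕ.+ 5 ℕ.* b′       ∎)
      where open ℕ.≤-Reasoning
    2a<3a : 2 ℕ.* a ℕ.< 3 ℕ.* a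
    2a<3a = ℕ.*-monoˡ-< a {{ℕ.>-nonZero (proj₁ bounds)}} (ℕ.n<1+n 2)
    b′≢0 : u t′ p ≢ 0ℤ
    b′≢0 u′≡0 = ℕ.<-irrefl refl (ℕ.<-≤-trans (proj₁ bounds)
      (ℕ.≤-trans (ℕ.m≤n*m a 3) (subst (λ w → 3 ℕ.* a ℕ.≤ 5 ℕ.* ∣ w ∣) u′≡0 3a≤5b′)))
    ¬cone′ : ¬ Cone t′ (Sign.opposite s′) p
    ¬cone′ c′ = ℕ.<-irrefl refl
      (ℕ.<-≤-trans 2a<3a (ℕ.≤-trans 3a≤5b′ (proj₂ (cone-bounds t′ (Sign.opposite s′) p c′))))


module FreeGroupAction (k : ℕ) where
  open PingPong
  open import Data.Integer using (_-_; _*_; _<_)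
  open ≡ using (sym; trans; cong; subst)

  index : Letter k → ℤ
  index (inj₁ i) = + toℕ i
  index (inj₂ i) = + toℕ i

  sign : Letter k → Sign
  sign (inj₁ _) = Sign.+
  sign (inj₂ _) = Sign.-

  letterMatrix : Letter k → Mat₂
  letterMatrix a = generator (index a) (sign a)

  act : Letter k → ℤ² → ℤ²
  act a p = p ·₂ letterMatrix a

  act-inverse : ∀ a p → act (inverse a) (act a p) ≡ p
  act-inverse (inj₁ i) = shear-inverse (+ toℕ i) (+ 5)
  act-inverse (inj₂ i) = shear-inverse (+ toℕ i) -[1+ 4 ]

  orbit : List (Letter k) → ℤ² → ℤ²
  orbit []      p = p
  orbit (a ∷ w) p = orbit w (act a p)

  -- In the omitted cases eq : false ≡ true.
  letter-eq?-sound : ∀ (a b : Letter k) → letter-eq? a b ≡ true → a ≡ b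
  letter-eq?-sound (inj₁ i) (inj₁ j) eq with i Fin.≟ j
  letter-eq?-sound (inj₁ i) (inj₁ i) eq | yes refl = refl
  letter-eq?-sound (inj₂ i) (inj₂ j) eq with i Fin.≟ j
  letter-eq?-sound (inj₂ i) (inj₂ i) eq | yes refl = refl

  orbit-cons-reduce : ∀ a r p → orbit (cons-reduce a r) p ≡ orbit r (act a p)
  orbit-cons-reduce a []      p = refl
  orbit-cons-reduce a (b ∷ r) p with letter-eq? (inverse a) b in eq
  ... | true  = cong (orbit r) (trans (sym (act-inverse a p))
                                      (cong (λ c → act c (act a p)) (letter-eq?-sound (inverse a) b eq)))
  ... | false = refl

  orbit-reduce : ∀ w p → orbit w p ≡ orbit (reduce w) p
  orbit-reduce []      p = refl
  orbit-reduce (a ∷ w) p = trans (orbit-reduce w (act a p)) (sym (orbit-cons-reduce a (reduce w) p))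

  NonCancelling : Letter k → Letter k → Set
  NonCancelling a b = letter-eq? (inverse a) b ≡ false

  Reduced : List (Letter k) → Set
  Reduced = Linked NonCancelling

  cons-reduce-reduced : ∀ a r → Reduced r → Reduced (cons-reduce a r)
  cons-reduce-reduced a []      _ = [-]
  cons-reduce-reduced a (b ∷ r) r-red with letter-eq? (inverse a) b in eq
  ... | true  = Linked.tail r-red
  ... | false = eq ∷ r-red

  reduce-reduced : ∀ w → Reduced (reduce w)
  reduce-reduced []      = []
  reduce-reduced (a ∷ w) = cons-reduce-reduced a (reduce w) (reduce-reduced w)

  LetterCone : Letter k → ℤ² → Set
  LetterCone a = Cone (index a) (sign a)

  LetterAdmissible : Letter k → ℤ² → Set
  LetterAdmissible a = Admissible (index a) (sign a)

  0<∣index-difference∣ : ∀ {i j : Fin.Fin k} → i ≢ j → 0 ℕ.< ∣ + toℕ j - + toℕ i ∣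
  0<∣index-difference∣ {i} {j} i≢j = ℕ.n≢0⇒n>0 λ ∣j-i∣≡0 →
    i≢j (sym (Fin.toℕ-injective (ℤ.+-injective (ℤ.i-j≡0⇒i≡j (+ toℕ j) (+ toℕ i) (ℤ.∣i∣≡0⇒i≡0 ∣j-i∣≡0)))))

  data NextLetter (a : Letter k) : Letter k → Set where
    same-letter : NextLetter a a
    other-index : ∀ {b} → 0 ℕ.< ∣ index b - index a ∣ → NextLetter a b

  -- The omitted cases (a letter followed by its inverse) have a NonCancelling proof of true ≡ false.
  next-letter : ∀ a b → NonCancelling a b → NextLetter a b
  next-letter (inj₁ i) (inj₁ j) _ with i Fin.≟ j
  ... | yes refl = same-letter
  ... | no i≢j   = other-index (0<∣index-difference∣ i≢j)
  next-letter (inj₂ i) (inj₂ j) _ with i Fin.≟ j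
  ... | yes refl = same-letter
  ... | no i≢j   = other-index (0<∣index-difference∣ i≢j)
  next-letter (inj₁ i) (inj₂ j) _ with i Fin.≟ j
  ... | no i≢j   = other-index (0<∣index-difference∣ i≢j)
  next-letter (inj₂ i) (inj₁ j) _ with i Fin.≟ j
  ... | no i≢j   = other-index (0<∣index-difference∣ i≢j)

  LetterCone⇒LetterAdmissible : ∀ a b q → NonCancelling a b → LetterCone a q → LetterAdmissible b q
  LetterCone⇒LetterAdmissible a b q nc c with next-letter a b nc
  ... | same-letter     = Cone⇒Admissible (index a) (sign a) q c
  ... | other-index d>0 = Cone⇒Admissible-other (index a) (index b) (sign a) (sign b) q d>0 c

  ping-pong : ∀ a w p → Reduced (a ∷ w) → LetterAdmissible a p → ∃ λ b → LetterCone b (orbit (a ∷ w) p)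
  ping-pong a []      p _          adm = a , generator-enters-cone (index a) (sign a) p adm
  ping-pong a (b ∷ w) p (nc ∷ red) adm =
    ping-pong b w (act a p) red (LetterCone⇒LetterAdmissible a b (act a p) nc (generator-enters-cone (index a) (sign a) p adm))

  origin : ℤ²
  origin = (0ℤ , 1ℤ)

  origin-admissible : ∀ a → LetterAdmissible a origin
  origin-admissible a = u≢0 , λ (0<P , _) → ℤ.<-irrefl refl (subst (0ℤ <_) (P≡0 (Sign.opposite (sign a))) 0<P)
    where
    u≢0 : u (index a) origin ≢ 0ℤ
    u≢0 u≡0 with trans (sym (cong (_-_ 1ℤ) (ℤ.*-zeroʳ (index a)))) u≡0
    ... | ()
    P≡0 : ∀ s → P (index a) s origin ≡ 0ℤ
    P≡0 s = cong (_* u (index a) origin) (ℤ.*-zeroʳ (ε s))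

  reduced-orbit-x≢0 : ∀ a r → Reduced (a ∷ r) → proj₁ (orbit (a ∷ r) origin) ≢ 0ℤ
  reduced-orbit-x≢0 a r red x≡0 with ping-pong a r origin red (origin-admissible a)
  ... | b , c = ℕ.<-irrefl refl
    (subst (λ x → 0 ℕ.< ∣ x ∣) x≡0 (proj₁ (cone-bounds (index b) (sign b) (orbit (a ∷ r) origin) c)))

  trivial⇔x≡0 : ∀ w → reduce w ≡ [] ⇔ proj₁ (orbit w origin) ≡ 0ℤ
  trivial⇔x≡0 w rewrite orbit-reduce w origin with reduce w | reduce-reduced w
  ... | []    | _   = mk⇔ (λ _ → refl) (λ _ → refl)
  ... | a ∷ r | red = mk⇔ (λ ()) (⊥-elim ∘ reduced-orbit-x≢0 a r red)

  quad-orbit : ∀ w p → linearOrbit (Sym² ∘ letterMatrix) (quad p) w ≗ quad (orbit w p)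
  quad-orbit []      p j = refl
  quad-orbit (a ∷ w) p j =
    trans (linearOrbit-cong (Sym² ∘ letterMatrix) (λ i → sym (quad-·₂ p (letterMatrix a) i)) w j) (quad-orbit w (act a p) j)

module RealFieldProperties (R : RealField) where
  open RealField R using (ℝ; 0ℝ; 1ℝ)
  private module F = RealField R
  open ≡ using (sym; trans; cong; cong₂; subst; subst₂)

  commutativeRing : CommutativeRing _ _
  commutativeRing = record { isCommutativeRing = isCommutativeRing }
    where
    open F using (_+_; _*_; -_)
    isCommutativeRing : IsCommutativeRing _≡_ _+_ _*_ -_ 0ℝ 1ℝ
    isCommutativeRing = record
      { isRing = record
        { +-isAbelianGroup = record
          { isGroup = record
            { isMonoid = record
              { isSemigroup = record
                { isMagma = record { isEquivalence = ≡.isEquivalence ; ∙-cong = cong₂ _+_ }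
                ; assoc = F.+-assoc }
              ; identity = F.+-identityˡ , λ x → trans (F.+-comm x 0ℝ) (F.+-identityˡ x) }
            ; inverse = F.+-inverseˡ , λ x → trans (F.+-comm x (- x)) (F.+-inverseˡ x)
            ; ⁻¹-cong = cong -_ }
          ; comm = F.+-comm }
        ; *-cong = cong₂ _*_
        ; *-assoc = F.*-assoc
        ; *-identity = F.*-identityˡ , λ x → trans (F.*-comm x 1ℝ) (F.*-identityˡ x)
        ; distrib = F.distribˡ , λ x y z → trans (F.*-comm (y + z) x)
                                             (trans (F.distribˡ x y z) (cong₂ _+_ (F.*-comm x y) (F.*-comm x z))) }
      ; *-comm = F.*-comm }

  open CommutativeRing commutativeRing public
    using (_+_; _*_; -_; _-_; +-comm; +-identityˡ; +-identityʳ; -‿inverseʳ; *-comm; *-assoc;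
           *-identityˡ; *-identityʳ; zeroˡ; zeroʳ; +-commutativeMonoid; semiring)
  open import Algebra.Properties.Ring (CommutativeRing.ring commutativeRing) public using (-‿distribˡ-*; -1*x≈-x; -‿involutive)
  open IntegerEmbedding commutativeRing public

  infix 4 _<_ _≤_
  _<_ : ℝ → ℝ → Set
  _<_ = F._<_
  _≤_ : ℝ → ℝ → Set
  _≤_ = F._≤_

  +-monoʳ-< : ∀ x {y z} → y < z → x + y < x + z
  +-monoʳ-< x {y} {z} y<z = subst₂ _<_ (+-comm y x) (+-comm z x) (F.+-mono-< y z x y<z)

  x<x+y : ∀ x {y} → 0ℝ < y → x < x + y
  x<x+y x {y} 0<y = subst (_< x + y) (+-identityʳ x) (+-monoʳ-< x 0<y)

  0<+ : ∀ {x y} → 0ℝ < x → 0ℝ < y → 0ℝ < x + y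
  0<+ {x} 0<x 0<y = F.<-trans 0ℝ x _ 0<x (x<x+y x 0<y)

  0<x⇒-x≮0 : ∀ {x} → 0ℝ < x → ¬ (0ℝ < - x)
  0<x⇒-x≮0 {x} 0<x 0<-x = F.<-irrefl 0ℝ (subst (0ℝ <_) (-‿inverseʳ x) (0<+ 0<x 0<-x))

  x<0⇒0<-x : ∀ {x} → x < 0ℝ → 0ℝ < - x
  x<0⇒0<-x {x} x<0 = subst₂ _<_ (-‿inverseʳ x) (+-identityˡ (- x)) (F.+-mono-< x 0ℝ (- x) x<0)

  0<1 : 0ℝ < 1ℝ
  0<1 with F.<-trichotomy 0ℝ 1ℝ
  ... | inj₁ 0<1         = 0<1
  ... | inj₂ (inj₁ 0≡1)  = ⊥-elim (F.0≢1 0≡1)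
  ... | inj₂ (inj₂ 1<0)  = ⊥-elim (0<x⇒-x≮0 0<[-1]*[-1] 0<-1)
    where
    0<-1 = x<0⇒0<-x 1<0
    0<[-1]*[-1] : 0ℝ < 1ℝ
    0<[-1]*[-1] = subst (0ℝ <_) (trans (-1*x≈-x (- 1ℝ)) (-‿involutive 1ℝ)) (F.*-pos _ _ 0<-1 0<-1)

  ι-nonneg : ∀ n → 0ℝ ≤ ι (+ n)
  ι-pos : ∀ n → 0ℝ < ι (+ suc n)
  ι-nonneg zero    = inj₂ refl
  ι-nonneg (suc n) = inj₁ (ι-pos n)
  ι-pos n with ι-nonneg n
  ... | inj₁ 0<n×1 = 0<+ 0<1 0<n×1
  ... | inj₂ 0≡n×1 = subst (λ y → 0ℝ < 1ℝ + y) 0≡n×1 (subst (0ℝ <_) (sym (+-identityʳ 1ℝ)) 0<1)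

  0≤* : ∀ {x y} → 0ℝ ≤ x → 0ℝ ≤ y → 0ℝ ≤ x * y
  0≤* (inj₁ 0<x) (inj₁ 0<y) = inj₁ (F.*-pos _ _ 0<x 0<y)
  0≤* {x} _ (inj₂ refl) = inj₂ (sym (zeroʳ x))
  0≤* {y = y} (inj₂ refl) _ = inj₂ (sym (zeroˡ y))

  recip : ℕ → ℝ
  recip c = F.inv (ι (+ suc c)) λ eq → F.<-irrefl 0ℝ (subst (0ℝ <_) eq (ι-pos c))

  ι*recip : ∀ c → ι (+ suc c) * recip c ≡ 1ℝ
  ι*recip c = trans (*-comm _ _) (F.*-inverseˡ _ _)

  0<recip : ∀ c → 0ℝ < recip c
  0<recip c with F.<-trichotomy 0ℝ (recip c)
  ... | inj₁ 0<r        = 0<r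
  ... | inj₂ (inj₁ 0≡r) = ⊥-elim (F.0≢1 (trans (sym (zeroʳ _)) (trans (cong (ι (+ suc c) *_) 0≡r) (ι*recip c))))
  ... | inj₂ (inj₂ r<0) = ⊥-elim (0<x⇒-x≮0 0<1
    (subst (0ℝ <_) (trans (sym (-‿distribˡ-* _ _)) (cong -_ (F.*-inverseˡ _ _))) (F.*-pos _ _ (x<0⇒0<-x r<0) (ι-pos c))))

  x-y≮x : ∀ x {y} → 0ℝ ≤ y → ¬ (x < x - y)
  x-y≮x x {y} 0≤y x<x-y =
    x+y≮x 0≤y (subst (x + y <_) (solve 2 (λ x y → (x :- y) :+ y := x) refl x y) (F.+-mono-< x (x - y) y x<x-y))
    where
    x+y≮x : ∀ {y} → 0ℝ ≤ y → ¬ (x + y < x)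
    x+y≮x (inj₁ 0<y) x+y<x = F.<-irrefl x (F.<-trans x _ x (x<x+y x 0<y) x+y<x)
    x+y≮x (inj₂ refl) x+0<x = F.<-irrefl x (subst (_< x) (+-identityʳ x) x+0<x)

module RowVectors (R : RealField) where
  open RealField R using (ℝ; 0ℝ; 1ℝ)
  open RealFieldProperties R
  open import Algebra.Properties.CommutativeMonoid.Sum +-commutativeMonoid using (sum; sum-cong-≗; ∑-comm; sum-replicate-zero)
  open import Algebra.Properties.Semiring.Sum semiring using (*-distribˡ-sum)
  open ≡ using (sym; trans; cong; cong₂)
  open ≡.≡-Reasoning

  sumFin≡sum : ∀ {m} (f : Fin m → ℝ) → sumFin R f ≡ sum f
  sumFin≡sum {zero}  f = refl
  sumFin≡sum {suc m} f = cong (_+_ (f zero)) (sumFin≡sum (f ∘ suc))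

  sumFin-cong : ∀ {m} {f g : Fin m → ℝ} → (∀ i → f i ≡ g i) → sumFin R f ≡ sumFin R g
  sumFin-cong {zero}  f≗g = refl
  sumFin-cong {suc m} f≗g = cong₂ _+_ (f≗g zero) (sumFin-cong (f≗g ∘ suc))

  sum-· : ∀ {m} (v : Fin m → ℝ) (M : Matrix R m) → (∀ i → sumFin R (M i) ≡ 1ℝ) → sumFin R (_·_ R v M) ≡ sumFin R v
  sum-· v M rows = begin
    sumFin R (_·_ R v M)                       ≡⟨ sumFin≡sum (_·_ R v M) ⟩
    sum (λ j → sumFin R (λ i → v i * M i j))   ≡⟨ sum-cong-≗ (λ j → sumFin≡sum (λ i → v i * M i j)) ⟩
    sum (λ j → sum (λ i → v i * M i j))        ≡⟨ ∑-comm (λ j i → v i * M i j) ⟩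
    sum (λ i → sum (λ j → v i * M i j))        ≡⟨ sum-cong-≗ (λ i → sym (*-distribˡ-sum (v i) (M i))) ⟩
    sum (λ i → v i * sum (M i))                ≡⟨ sum-cong-≗ (λ i → cong (v i *_) (trans (sym (sumFin≡sum (M i))) (rows i))) ⟩
    sum (λ i → v i * 1ℝ)                       ≡⟨ sum-cong-≗ (λ i → *-identityʳ (v i)) ⟩
    sum v                                      ≡⟨ sumFin≡sum v ⟨
    sumFin R v                                 ∎

  sum-zero : ∀ {m} (f : Fin m → ℝ) → (∀ l → f l ≡ 0ℝ) → sum f ≡ 0ℝ
  sum-zero {m} f f≡0 = trans (sum-cong-≗ f≡0) (sum-replicate-zero m)

  sum-sub : ∀ {m} (f g : Fin m → ℝ) → sum f - sum g ≡ sum (λ l → f l - g l)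
  sum-sub {zero}  f g = -‿inverseʳ 0ℝ
  sum-sub {suc m} f g = trans
    (solve 4 (λ a b c d → (a :+ b) :- (c :+ d) := (a :- c) :+ (b :- d)) refl (f zero) (sum (f ∘ suc)) (g zero) (sum (g ∘ suc)))
    (cong (_+_ (f zero - g zero)) (sum-sub (f ∘ suc) (g ∘ suc)))

  initVec-· : ∀ {m} (M : Matrix R (suc m)) j → _·_ R (initVec R) M j ≡ M zero j
  initVec-· {m} M j = begin
    1ℝ * M zero j + sumFin R (λ i → 0ℝ * M (suc i) j)   ≡⟨ cong₂ _+_ (*-identityˡ _) (sumFin≡sum (λ i → 0ℝ * M (suc i) j)) ⟩
    M zero j + sum (λ i → 0ℝ * M (suc i) j)             ≡⟨ cong (_+_ (M zero j)) (sum-zero _ λ i → zeroˡ (M (suc i) j)) ⟩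
    M zero j + 0ℝ                                        ≡⟨ +-identityʳ _ ⟩
    M zero j                                             ∎

module Simulation (R : RealField) (n : ℕ) where
  open RealField R using (ℝ; 0ℝ; 1ℝ)
  open RealFieldProperties R
  open RowVectors R
  open RoleSum +-commutativeMonoid
  module ℕᴿ = RoleSum ℕ.+-0-commutativeMonoid
  open import Algebra.Properties.CommutativeMonoid.Sum +-commutativeMonoid using (sum; sum-cong-≗)
  open import Algebra.Properties.Semiring.Sum semiring using (*-distribʳ-sum)
  open ≡ using (sym; trans; cong; cong₂; subst)
  private module F = RealField R
  open ≡.≡-Reasoning

  Weights : Set
  Weights = Role n → Role n → ℕ

  weighted : ℕ → Weights → Matrix R (stateCount n)
  weighted c W i j = ι (+ W (role i) (role j)) * recip c

  weighted-stochastic : ∀ c W → (∀ r → ℕᴿ.Σᴿ (W r) ≡ suc c) → Stochastic R (weighted c W)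
  weighted-stochastic c W rows = (λ i j → 0≤* (ι-nonneg (W (role i) (role j))) (inj₁ (0<recip c))) , λ i → begin
    sumFin R (λ j → ι (+ W (role i) (role j)) * recip c)     ≡⟨ sumFin≡sum (weighted c W i) ⟩
    sum (λ j → ι (+ W (role i) (role j)) * recip c)          ≡⟨ *-distribʳ-sum (recip c) (λ j → ι (+ W (role i) (role j))) ⟨
    sum (λ j → ι (+ W (role i) (role j))) * recip c          ≡⟨ cong (_* recip c) (ι-sum⁺ (λ j → W (role i) (role j))) ⟨
    ι (+ ℕΣ.sum (λ j → W (role i) (role j))) * recip c       ≡⟨ cong (λ m → ι (+ m) * recip c) (ℕᴿ.sum-by-role (λ _ → W (role i))) ⟩
    ι (+ ℕᴿ.Σᴿ (W (role i))) * recip c  ≡⟨ cong (λ m → ι (+ m) * recip c) (rows (role i)) ⟩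
    ι (+ suc c) * recip c                                     ≡⟨ ι*recip c ⟩
    1ℝ                                                        ∎

  _⟨_⟩ : (Fin (stateCount n) → ℝ) → Role n → ℝ
  v ⟨ r ⟩ = v (state r)

  inflow : Weights → (Fin (stateCount n) → ℝ) → Role n → ℝ
  inflow W v r′ = Σᴿ (λ r → v ⟨ r ⟩ * ι (+ W r r′))

  apply-weighted : ∀ c W v r′ → (_·_ R v (weighted c W)) ⟨ r′ ⟩ ≡ inflow W v r′ * recip c
  apply-weighted c W v r′ = begin
    sumFin R (λ i → v i * (ι (+ W (role i) (role (state r′))) * recip c))
      ≡⟨ sumFin≡sum (λ i → v i * (ι (+ W (role i) (role (state r′))) * recip c)) ⟩
    sum (λ i → v i * (ι (+ W (role i) (role (state r′))) * recip c))
      ≡⟨ sum-cong-≗ (λ i → trans (cong (λ r → v i * (ι (+ W (role i) r) * recip c)) (role-state r′))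
                                 (sym (*-assoc _ _ _))) ⟩
    sum (λ i → v i * ι (+ W (role i) r′) * recip c)
      ≡⟨ *-distribʳ-sum (recip c) (λ i → v i * ι (+ W (role i) r′)) ⟨
    sum (λ i → v i * ι (+ W (role i) r′)) * recip c
      ≡⟨ cong (_* recip c) (sum-by-role (λ i r → v i * ι (+ W r r′))) ⟩
    inflow W v r′ * recip c ∎

  record Encodes (v : Fin (stateCount n) → ℝ) (q : Fin n → ℤ) : Set where
    field
      reference-positive : 0ℝ < v ⟨ ref ⟩
      total              : sumFin R v ≡ 1ℝ
      difference         : ∀ j → v ⟨ pos j ⟩ - v ⟨ neg j ⟩ ≡ ι (q j) * v ⟨ ref ⟩

  IntMatrix : Set
  IntMatrix = Fin n → Fin n → ℤ

  rowMass : IntMatrix → Fin n → ℕ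
  rowMass M l = ℕΣ.sum (λ j → ℤ.∣ M l j ∣)

  bound : IntMatrix → ℕ
  bound M = ℕΣ.sum (rowMass M)

  rowMass≤bound : ∀ M l → rowMass M l ℕ.≤ suc (bound M)
  rowMass≤bound M l = ℕ.m≤n⇒m≤1+n (≤-sum (rowMass M) l)

  slack : IntMatrix → Fin n → ℕ
  slack M l = suc (bound M) ℕ.∸ rowMass M l

  stepWeights : IntMatrix → Weights
  stepWeights M ref     ref     = 1
  stepWeights M ref     sink    = bound M
  stepWeights M sink    sink    = suc (bound M)
  stepWeights M (pos l) (pos j) = positivePart (M l j)
  stepWeights M (pos l) (neg j) = negativePart (M l j)
  stepWeights M (neg l) (pos j) = negativePart (M l j)
  stepWeights M (neg l) (neg j) = positivePart (M l j)
  stepWeights M (pos l) sink    = slack M l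
  stepWeights M (neg l) sink    = slack M l
  stepWeights M _       _       = 0

  stepWeights-rows : ∀ M r → ℕᴿ.Σᴿ (stepWeights M r) ≡ suc (bound M)
  stepWeights-rows M ref     = cong suc (trans (cong (bound M ℕ.+_) (ℕΣ.sum-replicate-zero n)) (ℕ.+-identityʳ (bound M)))
  stepWeights-rows M sink    = cong suc (trans (cong (bound M ℕ.+_) (ℕΣ.sum-replicate-zero n)) (ℕ.+-identityʳ (bound M)))
  stepWeights-rows M (pos l) = begin
    slack M l ℕ.+ ℕΣ.sum (λ j → positivePart (M l j) ℕ.+ negativePart (M l j))
      ≡⟨ cong (slack M l ℕ.+_) (ℕΣ.sum-cong-≗ (λ j → positivePart+negativePart (M l j))) ⟩
    slack M l ℕ.+ rowMass M l   ≡⟨ ℕ.m∸n+n≡m (rowMass≤bound M l) ⟩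
    suc (bound M)               ∎
  stepWeights-rows M (neg l) = begin
    slack M l ℕ.+ ℕΣ.sum (λ j → negativePart (M l j) ℕ.+ positivePart (M l j))
      ≡⟨ cong (slack M l ℕ.+_) (ℕΣ.sum-cong-≗ λ j →
           trans (ℕ.+-comm (negativePart (M l j)) _) (positivePart+negativePart (M l j))) ⟩
    slack M l ℕ.+ rowMass M l   ≡⟨ ℕ.m∸n+n≡m (rowMass≤bound M l) ⟩
    suc (bound M)               ∎

  step-reference : ∀ M v → inflow (stepWeights M) v ref ≡ v ⟨ ref ⟩
  step-reference M v = trans
    (cong (λ s → v ⟨ ref ⟩ * ι (+ 1) + (v ⟨ sink ⟩ * 0ℝ + s))
          (sum-zero _ λ l → solve 2 (λ x y → x :* con (+ 0) :+ y :* con (+ 0) := con (+ 0)) refl (v ⟨ pos l ⟩) (v ⟨ neg l ⟩)))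
    (solve 2 (λ a b → a :* con (+ 1) :+ (b :* con (+ 0) :+ con (+ 0)) := a) refl (v ⟨ ref ⟩) (v ⟨ sink ⟩))

  step-difference : ∀ M v q → (∀ l → v ⟨ pos l ⟩ - v ⟨ neg l ⟩ ≡ ι (q l) * v ⟨ ref ⟩) → ∀ j →
    inflow (stepWeights M) v (pos j) - inflow (stepWeights M) v (neg j) ≡ ι ((q ᵛ* M) j) * v ⟨ ref ⟩
  step-difference M v q diff j = begin
    (a * 0ℝ + (b * 0ℝ + sum P)) - (a * 0ℝ + (b * 0ℝ + sum N))
      ≡⟨ solve 4 (λ a b p n → (a :* con (+ 0) :+ (b :* con (+ 0) :+ p)) :- (a :* con (+ 0) :+ (b :* con (+ 0) :+ n))
                              := p :- n) refl a b (sum P) (sum N) ⟩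
    sum P - sum N
      ≡⟨ sum-sub P N ⟩
    sum (λ l → P l - N l)
      ≡⟨ sum-cong-≗ (λ l → trans (pair l) (cong₂ _*_ (diff l) (ι-parts (M l j)))) ⟩
    sum (λ l → ι (q l) * v ⟨ ref ⟩ * ι (M l j))
      ≡⟨ sum-cong-≗ (λ l → trans (solve 3 (λ x z m → x :* z :* m := x :* m :* z) refl (ι (q l)) (v ⟨ ref ⟩) (ι (M l j)))
                                 (cong (_* v ⟨ ref ⟩) (sym (ι-* (q l) (M l j))))) ⟩
    sum (λ l → ι (q l ℤ.* M l j) * v ⟨ ref ⟩)
      ≡⟨ *-distribʳ-sum (v ⟨ ref ⟩) (λ l → ι (q l ℤ.* M l j)) ⟨
    sum (λ l → ι (q l ℤ.* M l j)) * v ⟨ ref ⟩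
      ≡⟨ cong (_* v ⟨ ref ⟩) (ι-sum (λ l → q l ℤ.* M l j)) ⟨
    ι ((q ᵛ* M) j) * v ⟨ ref ⟩ ∎
    where
    a = v ⟨ ref ⟩
    b = v ⟨ sink ⟩
    P N : Fin n → ℝ
    P l = v ⟨ pos l ⟩ * ι (+ positivePart (M l j)) + v ⟨ neg l ⟩ * ι (+ negativePart (M l j))
    N l = v ⟨ pos l ⟩ * ι (+ negativePart (M l j)) + v ⟨ neg l ⟩ * ι (+ positivePart (M l j))
    pair : ∀ l → P l - N l ≡ (v ⟨ pos l ⟩ - v ⟨ neg l ⟩) * (ι (+ positivePart (M l j)) - ι (+ negativePart (M l j)))
    pair l = solve 4 (λ x y p m → (x :* p :+ y :* m) :- (x :* m :+ y :* p) := (x :- y) :* (p :- m)) refl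
               (v ⟨ pos l ⟩) (v ⟨ neg l ⟩) (ι (+ positivePart (M l j))) (ι (+ negativePart (M l j)))

  stepMatrix : IntMatrix → Matrix R (stateCount n)
  stepMatrix M = weighted (bound M) (stepWeights M)

  stepMatrix-stochastic : ∀ M → Stochastic R (stepMatrix M)
  stepMatrix-stochastic M = weighted-stochastic (bound M) (stepWeights M) (stepWeights-rows M)

  step-encodes : ∀ M {v q} → Encodes v q → Encodes (_·_ R v (stepMatrix M)) (q ᵛ* M)
  step-encodes M {v} {q} e = record
    { reference-positive = subst (0ℝ <_) (sym reference) (F.*-pos _ _ reference-positive (0<recip (bound M)))
    ; total = trans (sum-· v (stepMatrix M) (proj₂ (stepMatrix-stochastic M))) total
    ; difference = λ j → begin
        v′ ⟨ pos j ⟩ - v′ ⟨ neg j ⟩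
          ≡⟨ cong₂ _-_ (apply-weighted (bound M) W v (pos j)) (apply-weighted (bound M) W v (neg j)) ⟩
        inflow W v (pos j) * κ - inflow W v (neg j) * κ
          ≡⟨ solve 3 (λ x y k → x :* k :- y :* k := (x :- y) :* k) refl (inflow W v (pos j)) (inflow W v (neg j)) κ ⟩
        (inflow W v (pos j) - inflow W v (neg j)) * κ
          ≡⟨ cong (_* κ) (step-difference M v q difference j) ⟩
        ι ((q ᵛ* M) j) * v ⟨ ref ⟩ * κ
          ≡⟨ *-assoc _ _ _ ⟩
        ι ((q ᵛ* M) j) * (v ⟨ ref ⟩ * κ)
          ≡⟨ cong (ι ((q ᵛ* M) j) *_) reference ⟨
        ι ((q ᵛ* M) j) * v′ ⟨ ref ⟩ ∎
    }
    where
    open Encodes e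
    W = stepWeights M
    κ = recip (bound M)
    v′ = _·_ R v (stepMatrix M)
    reference : v′ ⟨ ref ⟩ ≡ v ⟨ ref ⟩ * κ
    reference = trans (apply-weighted (bound M) W v ref) (cong (_* κ) (step-reference M v))

  initWeights : (Fin n → ℕ) → Weights
  initWeights q₀ _ ref     = 1
  initWeights q₀ _ (pos j) = q₀ j
  initWeights q₀ _ _       = 0

  initMatrix : (Fin n → ℕ) → Matrix R (stateCount n)
  initMatrix q₀ = weighted (ℕΣ.sum q₀) (initWeights q₀)

  initMatrix-stochastic : ∀ q₀ → Stochastic R (initMatrix q₀)
  initMatrix-stochastic q₀ = weighted-stochastic (ℕΣ.sum q₀) (initWeights q₀)
    (λ _ → cong suc (ℕΣ.sum-cong-≗ (λ j → ℕ.+-identityʳ (q₀ j))))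

  init-encodes : ∀ q₀ → Encodes (_·_ R (initVec R) (initMatrix q₀)) (λ j → + q₀ j)
  init-encodes q₀ = record
    { reference-positive = subst (0ℝ <_) (sym (entry ref)) (F.*-pos _ _ (ι-pos 0) (0<recip c))
    ; total = trans (sumFin-cong (initVec-· (initMatrix q₀))) (proj₂ (initMatrix-stochastic q₀) zero)
    ; difference = λ j → trans (cong₂ _-_ (entry (pos j)) (entry (neg j)))
        (trans (solve 2 (λ x k → x :* k :- con (+ 0) :* k := x :* (con (+ 1) :* k)) refl (ι (+ q₀ j)) (recip c))
               (cong (ι (+ q₀ j) *_) (sym (entry ref))))
    }
    where
    c = ℕΣ.sum q₀
    entry : ∀ r → (_·_ R (initVec R) (initMatrix q₀)) ⟨ r ⟩ ≡ ι (+ initWeights q₀ ref r) * recip c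
    entry r = trans (initVec-· (initMatrix q₀) (state r)) (cong (λ r′ → ι (+ initWeights q₀ ref r′) * recip c) (role-state r))

module Automaton (R : RealField) {A : Set} (m : ℕ) (M : A → Fin (suc m) → Fin (suc m) → ℤ) (q₀ : Fin (suc m) → ℕ) where
  open RealField R using (ℝ; 0ℝ; 1ℝ)
  open RealFieldProperties R
  open RowVectors R
  open Simulation R (suc m)
  open RoleSum +-commutativeMonoid
  open import Algebra.Properties.CommutativeMonoid.Sum +-commutativeMonoid using (sum; sum-cong-≗)
  open ≡ using (sym; trans; cong; cong₂; subst)
  private module F = RealField R

  -- The accepted mass is ½ (2 v⟨ref⟩ + 0 v⟨pos 0⟩ + 2 v⟨neg 0⟩ + the mass of all other states),
  -- that is ½ + ½ (v⟨ref⟩ − (v⟨pos 0⟩ − v⟨neg 0⟩)) since the total mass is 1.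
  acceptWeight : Role (suc m) → ℕ
  acceptWeight ref           = 2
  acceptWeight sink          = 1
  acceptWeight (pos zero)    = 0
  acceptWeight (neg zero)    = 2
  acceptWeight (pos (suc _)) = 1
  acceptWeight (neg (suc _)) = 1

  testWeights : Weights
  testWeights r ref  = acceptWeight r
  testWeights r sink = 2 ℕ.∸ acceptWeight r
  testWeights r _    = 0

  testMatrix : Matrix R (stateCount (suc m))
  testMatrix = weighted 1 testWeights

  testMatrix-stochastic : Stochastic R testMatrix
  testMatrix-stochastic = weighted-stochastic 1 testWeights λ r →
    trans (cong (λ s → acceptWeight r ℕ.+ (2 ℕ.∸ acceptWeight r ℕ.+ s)) (ℕΣ.sum-replicate-zero (suc m))) (two r)
    where
    two : ∀ r → acceptWeight r ℕ.+ (2 ℕ.∸ acceptWeight r ℕ.+ 0) ≡ 2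
    two ref           = refl
    two sink          = refl
    two (pos zero)    = refl
    two (neg zero)    = refl
    two (pos (suc _)) = refl
    two (neg (suc _)) = refl

  isReference : Role (suc m) → Bool
  isReference ref = true
  isReference _   = false

  automaton : PFA R A (stateCount (suc m))
  automaton = record
    { mat        = λ { (symbol a) → stepMatrix (M a) ; cent → initMatrix q₀ ; dollar → testMatrix }
    ; stochastic = λ { (symbol a) → stepMatrix-stochastic (M a)
                     ; cent       → initMatrix-stochastic q₀
                     ; dollar     → testMatrix-stochastic }
    ; accepting  = λ i → isReference (role i)
    }

  run-encodes : ∀ w {v q} → Encodes v q → Encodes (run R automaton v w) (linearOrbit M q w)
  run-encodes []      e = e
  run-encodes (a ∷ w) e = run-encodes w (step-encodes (M a) e)

  half : ℝ
  half = recip 1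

  accepted : (Fin (stateCount (suc m)) → ℝ) → ℝ
  accepted u = sumFin R (λ i → if isReference (role i) then u i else 0ℝ)

  accepted≡reference : ∀ u → accepted u ≡ u ⟨ ref ⟩
  accepted≡reference u = begin
    accepted u                                                   ≡⟨ sumFin≡sum (λ i → if isReference (role i) then u i else 0ℝ) ⟩
    sum (λ i → if isReference (role i) then u i else 0ℝ)         ≡⟨ sum-by-role {n = suc m} (λ i r → if isReference r then u i else 0ℝ) ⟩
    u ⟨ ref ⟩ + (0ℝ + sum {suc m} (λ _ → 0ℝ + 0ℝ))
      ≡⟨ cong (λ s → u ⟨ ref ⟩ + (0ℝ + s)) (sum-zero {suc m} (λ _ → 0ℝ + 0ℝ) (λ _ → +-identityˡ 0ℝ)) ⟩
    u ⟨ ref ⟩ + (0ℝ + 0ℝ)                                        ≡⟨ solve 1 (λ x → x :+ (con (+ 0) :+ con (+ 0)) := x) refl (u ⟨ ref ⟩) ⟩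
    u ⟨ ref ⟩                                                    ∎
    where open ≡.≡-Reasoning

  acceptance : ∀ {v q} → Encodes v q → accepted (_·_ R v testMatrix) ≡ half + half * (v ⟨ ref ⟩ - ι (q zero) * v ⟨ ref ⟩)
  acceptance {v} {q} e = begin
    accepted (_·_ R v testMatrix)
      ≡⟨ accepted≡reference (_·_ R v testMatrix) ⟩
    (_·_ R v testMatrix) ⟨ ref ⟩
      ≡⟨ apply-weighted 1 testWeights v ref ⟩
    (a * ι (+ 2) + (b * ι (+ 1) + ((p * 0ℝ + n * ι (+ 2)) + T))) * half
      ≡⟨ cong (λ t → (a * ι (+ 2) + (b * ι (+ 1) + ((p * 0ℝ + n * ι (+ 2)) + t))) * half) T≡S ⟩
    (a * ι (+ 2) + (b * ι (+ 1) + ((p * 0ℝ + n * ι (+ 2)) + S))) * half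
      ≡⟨ solve 6 (λ a b p n s h → (a :* con (+ 2) :+ (b :* con (+ 1) :+ ((p :* con (+ 0) :+ n :* con (+ 2)) :+ s))) :* h
                                  := h :* (a :+ (b :+ ((p :+ n) :+ s))) :+ h :* (a :- (p :- n))) refl a b p n S half ⟩
    half * (a + (b + ((p + n) + S))) + half * (a - (p - n))
      ≡⟨ cong₂ (λ t d → half * t + half * (a - d)) total′ (difference zero) ⟩
    half * 1ℝ + half * (a - ι (q zero) * a)
      ≡⟨ cong (_+ half * (a - ι (q zero) * a)) (*-identityʳ half) ⟩
    half + half * (a - ι (q zero) * a) ∎
    where
    open Encodes e
    open ≡.≡-Reasoning
    a = v ⟨ ref ⟩
    b = v ⟨ sink ⟩
    p = v ⟨ pos zero ⟩
    n = v ⟨ neg zero ⟩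
    S = sum {m} (λ l → v ⟨ pos (suc l) ⟩ + v ⟨ neg (suc l) ⟩)
    T = sum {m} (λ l → v ⟨ pos (suc l) ⟩ * ι (+ 1) + v ⟨ neg (suc l) ⟩ * ι (+ 1))
    T≡S : T ≡ S
    T≡S = sum-cong-≗ {m} λ l →
      solve 2 (λ x y → x :* con (+ 1) :+ y :* con (+ 1) := x :+ y) refl (v ⟨ pos (suc l) ⟩) (v ⟨ neg (suc l) ⟩)
    total′ : a + (b + ((p + n) + S)) ≡ 1ℝ
    total′ = trans (sym (sum-by-role {n = suc m} (λ i _ → v i))) (trans (sym (sumFin≡sum v)) total)

  0<half : 0ℝ < half
  0<half = 0<recip 1

  half<1 : half < 1ℝ
  half<1 = subst (half <_) (trans (solve 1 (λ h → h :+ h := con (+ 2) :* h) refl half) (ι*recip 1)) (x<x+y half 0<half)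

  above-half⇔ : ∀ {z} k → 0ℝ < z → (half < half + half * (z - ι (+ k) * z)) ⇔ k ≡ 0
  above-half⇔ {z} zero    0<z = mk⇔ (λ _ → refl) λ _ →
    subst (half <_) (solve 2 (λ h z → h :+ h :* z := h :+ h :* (z :- con (+ 0) :* z)) refl half z)
                    (x<x+y half (F.*-pos _ _ 0<half 0<z))
  above-half⇔ {z} (suc k) 0<z = mk⇔ (⊥-elim ∘ x-y≮x half 0≤h[kz] ∘ subst (half <_) below) λ ()
    where
    0≤h[kz] : 0ℝ ≤ half * (ι (+ k) * z)
    0≤h[kz] = 0≤* (inj₁ 0<half) (0≤* (ι-nonneg k) (inj₁ 0<z))
    below : half + half * (z - ι (+ suc k) * z) ≡ half - half * (ι (+ k) * z)
    below = trans (cong (λ c → half + half * (z - c * z)) (ι-+ (+ 1) (+ k)))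
                  (solve 3 (λ h z i → h :+ h :* (z :- (con (+ 1) :+ i) :* z) := h :- h :* (i :* z)) refl half z (ι (+ k)))

  accepts⇔ : ∀ w k → linearOrbit M (λ j → + q₀ j) w zero ≡ + k → (half < accProb R automaton w) ⇔ k ≡ 0
  accepts⇔ w k orbit≡k = subst (λ x → (half < x) ⇔ k ≡ 0) (sym accProb≡) (above-half⇔ k reference-positive)
    where
    v = run R automaton (_·_ R (initVec R) (initMatrix q₀)) w
    e = run-encodes w (init-encodes q₀)
    open Encodes e
    accProb≡ : accProb R automaton w ≡ half + half * (v ⟨ ref ⟩ - ι (+ k) * v ⟨ ref ⟩)
    accProb≡ = trans (acceptance e) (cong (λ i → half + half * (v ⟨ ref ⟩ - ι i * v ⟨ ref ⟩)) orbit≡k)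

theorem4p4 : (R : RealField) → (k : ℕ) → k ≥ 2 → Stochastic-Language R (Letter k) (Lwp k)
theorem4p4 R k _ =
  _ , automaton , half , inj₁ 0<half , half<1 , λ w → Equivalence.to (accepts w) , Equivalence.from (accepts w)
  where
  open FreeGroupAction k
  open Automaton R 2 (Sym² ∘ letterMatrix) (λ j → ∣ quad origin j ∣)
  open RealFieldProperties R using (_<_)

  quad-origin : ∀ j → + ∣ quad origin j ∣ ≡ quad origin j
  quad-origin zero             = refl
  quad-origin (suc zero)       = refl
  quad-origin (suc (suc zero)) = refl

  accepts : ∀ w → Lwp k w ⇔ half < accProb R automaton w
  accepts w = ⇔.trans (trivial⇔x≡0 w) (⇔.trans (i≡0⇔∣i∣*∣i∣≡0 x) (⇔.sym (accepts⇔ w _ first-coordinate)))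
    where
    x = proj₁ (orbit w origin)
    first-coordinate : linearOrbit (Sym² ∘ letterMatrix) (λ j → + ∣ quad origin j ∣) w zero ≡ + (∣ x ∣ ℕ.* ∣ x ∣)
    first-coordinate = ≡.trans (linearOrbit-cong (Sym² ∘ letterMatrix) quad-origin w zero)
                               (≡.trans (quad-orbit w origin zero) (i*i≡∣i∣*∣i∣ x))
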